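{- Let $a,b,c\subseteq[n]$. Then \[ \theta(a\otimes b\otimes c)=\theta(e^{\downarrow\star}_1(a\otimes b\otimes c)). \] Furthermore, for any $b_1,\dots,b_L\subseteq[n]$ and any $1\le i<L$, \[ \theta(b_1\otimes\cdots\otimes b_L)=\theta(e^{\downarrow\star}_i(b_1\otimes\cdots\otimes b_L)). \]
   Context: A tuple $b_1\otimes\cdots\otimes b_L$ of subsets of $[n]$ is viewed as an array with rows $1,\dots,L$ from bottom to top and columns $1,\dots,n$, with a ball at $(r,c)$ iff $c\in b_r$. Its column word $cw$ lists the row indices of the balls reading columns left to right, each column from top to bottom. Bracketing w.r.t. $j$: replace each $j$ by ")" and each $j+1$ by "(" (ignore other letters), and iteratively match a "(" with a ")" to its right whenever no unmatched parenthesis lies between them; letters not matched are unmatched. For $a,b\subseteq[n]$, $\theta(a\otimes b)\subseteq a$ is the set of elements of $a$ whose letter $1$ is matched in the bracketing w.r.t. $1$ of the column word of the two-row array $a\otimes b$ ($a$ is row 1, $b$ is row 2). Recursively, $\theta(b_1\otimes\cdots\otimes b_L)=\theta(b_1\otimes\theta(b_2\otimes\cdots\theta(b_{L-1}\otimes b_L)\cdots))$, evaluated from the inside out. $e^{\downarrow}_j$ moves the ball corresponding to the leftmost unmatched $j+1$ (bracketing w.r.t. $j$ of the column word) from row $j+1$ to row $j$ in the same column (identity if none); equivalently it acts only on the pair $b_j\otimes b_{j+1}$. $e^{\downarrow\star}_j$ applies $e^{\downarrow}_j$ repeatedly until it acts trivially (i.e. moves all unmatched balls of row $j+1$ down to row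 $j$). -}

module Defs where

open import Data.Bool using (Bool; true; false; if_then_else_; _∧_)
open import Data.Nat using (ℕ; zero; suc; _≡ᵇ_)
open import Data.Fin using (Fin; toℕ)
open import Data.Fin.Subset using (Subset)
open import Data.Product using (_×_; _,_; proj₁; proj₂)
open import Data.Maybe using (Maybe; just; nothing)
open import Data.List as List using (List; []; _∷_; [_]; concatMap; zip; upTo; length)
open import Data.Bool.ListAction using (any)
open import Data.Vec as Vec using (Vec; []; _∷_; lookup; updateAt; tabulate)

-- A tuple b₁ ⊗ ⋯ ⊗ b_L of subsets of [n] (columns 1..n ↔ Fin n);
-- vector position 0 is row 1 (bottom), position L-1 is row L (top).
Tensor : ℕ → ℕ → Set
Tensor n L = Vec (Subset n) L

-- A ball: (row index r ∈ {1..L}, column c).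
Ball : ℕ → Set
Ball n = ℕ × Fin n

-- Column word, with each letter (a row index) tagged by its column:
-- columns left to right, each column read from top (row L) to bottom (row 1).
colWordT : ∀ {n L} → Tensor n L → List (Ball n)
colWordT {n} {L} bs =
  concatMap
    (λ c → concatMap
      (λ r → if lookup (lookup bs r) c then [ (suc (toℕ r) , c) ] else [])
      (List.reverse (List.allFin L)))
    (List.allFin n)

colWord : ∀ {n L} → Tensor n L → List ℕ
colWord bs = List.map proj₁ (colWordT bs)

-- Bracketing w.r.t. j: letter j is ")", letter j+1 is "(".
-- Left-to-right scan with a stack of currently unmatched "(" positions;
-- returns the list of positions (0-based) of matched letters.
matchGo : ℕ → List ℕ → ℕ → List ℕ → List ℕ
matchGo j stack k [] = []
matchGo j stack k (x ∷ xs) with x ≡ᵇ suc j | x ≡ᵇ j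
... | true  | _     = matchGo j (k ∷ stack) (suc k) xs
... | false | false = matchGo j stack (suc k) xs
... | false | true  with stack
...   | []       = matchGo j [] (suc k) xs
...   | (p ∷ st) = p ∷ k ∷ matchGo j st (suc k) xs

matchedFlags : ℕ → List ℕ → List Bool
matchedFlags j w = List.map (λ k → any (k ≡ᵇ_) (matchGo j [] 0 w)) (upTo (length w))

bracketed : ∀ {n L} → ℕ → Tensor n L → List (Ball n × Bool)
bracketed j bs = zip (colWordT bs) (matchedFlags j (colWord bs))

θ₂ : ∀ {n} → Subset n → Subset n → Subset n
θ₂ a b = tabulate λ c →
  any (λ { ((r , c′) , m) → (r ≡ᵇ 1) ∧ (toℕ c′ ≡ᵇ toℕ c) ∧ m })
      (bracketed 1 (a ∷ b ∷ []))

θ : ∀ {n k} → Tensor n (suc k) → Subset n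
θ (b ∷ [])     = b
θ (b ∷ c ∷ bs) = θ₂ b (θ (c ∷ bs))

firstUnmatched : ∀ {n} → ℕ → List (Ball n × Bool) → Maybe (Fin n)
firstUnmatched j [] = nothing
firstUnmatched j (((r , c) , m) ∷ xs) with r ≡ᵇ suc j | m
... | true | false = just c
... | _    | _     = firstUnmatched j xs

-- update the factor in row r (1-based) of a tensor
updRow : ∀ {n L} → ℕ → (Subset n → Subset n) → Tensor n L → Tensor n L
updRow r f [] = []
updRow zero f (b ∷ bs) = b ∷ bs
updRow (suc zero) f (b ∷ bs) = f b ∷ bs
updRow (suc (suc r)) f (b ∷ bs) = b ∷ updRow (suc r) f bs

eDownStep : ∀ {n L} → ℕ → Tensor n L → Maybe (Tensor n L)
eDownStep j bs with firstUnmatched j (bracketed j bs)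
... | nothing = nothing
... | just c  = just (updRow j (λ s → updateAt s c (λ _ → true))
                       (updRow (suc j) (λ s → updateAt s c (λ _ → false)) bs))

eDown : ∀ {n L} → ℕ → Tensor n L → Tensor n L
eDown j bs with eDownStep j bs
... | nothing  = bs
... | just bs′ = bs′

eDownStarFuel : ∀ {n L} → ℕ → ℕ → Tensor n L → Tensor n L
eDownStarFuel zero    j bs = bs
eDownStarFuel (suc f) j bs with eDownStep j bs
... | nothing  = bs
... | just bs′ = eDownStarFuel f j bs′

-- e↓⋆_j: each nontrivial step removes a ball from row j+1 (which holds
-- at most n balls), so fuel n suffices to reach the point where e↓_j acts trivially.
eDownStar : ∀ {n L} → ℕ → Tensor n L → Tensor n L
eDownStar {n} j bs = eDownStarFuel n j bs

-- θ reads the array two rows at a time: θ(a ⊗ s) is a left-to-right scan over the columns that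
-- counts the balls of s not yet matched, and the bracketing w.r.t. j, restricted to rows j and
-- j+1, is the same scan. The ball moved by e↓_j sits in the column c of the leftmost unmatched
-- j+1, so the (j, j+1)-counter is 0 just before c and stays positive after c. Moving the ball down
-- turns it into an unmatched j and lowers all later counters by one without reaching 0, so
-- θ(b_j ⊗ b_{j+1}) does not change; neither does θ(b_j ⊗ θ(b_{j+1} ⊗ s)), because
-- θ(b_{j+1} ⊗ s) ⊆ b_{j+1} keeps its own counter below the (j, j+1)-counter. The rows below j
-- only see θ(b_j ⊗ ⋯), so every step of e↓⋆_j preserves θ.
module Submission where

open import Defs
open import Data.Bool using (Bool; true; false; _∧_; _∨_; if_then_else_)
import Data.Bool as Bool
import Data.Bool.Properties as BoolP
open import Data.Bool.ListAction using (any)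
open import Data.Empty using (⊥-elim) renaming (⊥ to Empty)
open import Data.Fin using (Fin; zero; suc; toℕ)
open import Data.Fin.Subset using (Subset) renaming (⊥ to ∅)
open import Data.List as List using (List; []; _∷_; _++_; [_]; length; applyUpTo; concatMap)
import Data.List.Properties as ListP
open import Data.List.Relation.Unary.All as All using (All; []; _∷_)
open import Data.Maybe as Maybe using (Maybe; just; nothing)
open import Data.Nat using (ℕ; zero; suc; pred; _+_; _≤_; _<_; z≤n; s≤s; _≡ᵇ_)
import Data.Nat.Properties as ℕP
open import Data.Product as Product using (_×_; _,_; proj₁)
open import Data.Unit using (⊤)
open import Data.Vec as Vec using (Vec; []; _∷_; lookup; updateAt)
import Data.Vec.Properties as VecP
open import Function using (_∘_)
open import Relation.Binary.PropositionalEquality hiding ([_])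

-- The counter scan of two rows

-- Row a carries the letter j (a ")"), row b the letter j+1 (a "("); the counter d is the number
-- of unmatched "(" read so far, and within a column the ball of b is read before that of a.
counterAfter : ℕ → Bool → Bool → ℕ
counterAfter d false false = d
counterAfter d false true  = suc d
counterAfter d true  false = pred d
counterAfter d true  true  = d

isPositive : ℕ → Bool
isPositive zero    = false
isPositive (suc _) = true

closesBracket : ℕ → Bool → Bool → Bool
closesBracket d a b = a ∧ (b ∨ isPositive d)

pairScan : ∀ {n} → ℕ → Vec Bool n → Vec Bool n → Vec Bool n
pairScan d []       []       = []
pairScan d (a ∷ as) (b ∷ bs) = closesBracket d a b ∷ pairScan (counterAfter d a b) as bs

StaysPositive : ∀ {n} → ℕ → Vec Bool n → Vec Bool n → Set
StaysPositive d []       []       = ⊤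
StaysPositive d (a ∷ as) (b ∷ bs) = 1 ≤ counterAfter d a b × StaysPositive (counterAfter d a b) as bs

Movable : ∀ {n} → ℕ → Vec Bool n → Vec Bool n → Fin n → Set
Movable d (a ∷ as) (b ∷ bs) zero    = d ≡ 0 × b ≡ true × a ≡ false × StaysPositive 1 as bs
Movable d (a ∷ as) (b ∷ bs) (suc c) = Movable (counterAfter d a b) as bs c

addAt delAt : ∀ {n} → Fin n → Vec Bool n → Vec Bool n
addAt c v = updateAt v c (λ _ → true)
delAt c v = updateAt v c (λ _ → false)

pairScan-suc : ∀ {n} d (a b : Vec Bool n) → StaysPositive (suc d) a b →
               pairScan (suc d) a b ≡ pairScan d a b
pairScan-suc d       []          []          _        = refl
pairScan-suc d       (false ∷ a) (false ∷ b) (_ , ok) = cong (false ∷_) (pairScan-suc d a b ok)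
pairScan-suc d       (false ∷ a) (true ∷ b)  (_ , ok) = cong (false ∷_) (pairScan-suc (suc d) a b ok)
pairScan-suc (suc d) (true ∷ a)  (false ∷ b) (_ , ok) = cong (true ∷_) (pairScan-suc d a b ok)
pairScan-suc d       (true ∷ a)  (true ∷ b)  (_ , ok) = cong (true ∷_) (pairScan-suc d a b ok)

pairScan-move : ∀ {n} d (a b : Vec Bool n) c → Movable d a b c →
                pairScan d a b ≡ pairScan d (addAt c a) (delAt c b)
pairScan-move d (a₀ ∷ a) (b₀ ∷ b) (suc c) m =
  cong (closesBracket d a₀ b₀ ∷_) (pairScan-move (counterAfter d a₀ b₀) a b c m)
pairScan-move .0 (.false ∷ a) (.true ∷ b) zero (refl , refl , refl , ok) =
  cong (false ∷_) (pairScan-suc 0 a b ok)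

-- An extra open bracket in the inner scan lets it match one more ball of b, which hands the outer
-- scan exactly the "(" its lower counter lacks.
pairScan-suc-nested : ∀ {n} d k (a b t : Vec Bool n) → StaysPositive (suc d) a b →
  pairScan (suc d) a (pairScan k b t) ≡ pairScan d a (pairScan (suc k) b t)
pairScan-suc-nested d       k       []          []          []          _        = refl
pairScan-suc-nested d       k       (false ∷ a) (false ∷ b) (false ∷ t) (_ , ok) = cong (false ∷_) (pairScan-suc-nested d k a b t ok)
pairScan-suc-nested d       k       (false ∷ a) (false ∷ b) (true ∷ t)  (_ , ok) = cong (false ∷_) (pairScan-suc-nested d (suc k) a b t ok)
pairScan-suc-nested (suc d) k       (true ∷ a)  (false ∷ b) (false ∷ t) (_ , ok) = cong (true ∷_) (pairScan-suc-nested d k a b t ok)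
pairScan-suc-nested (suc d) k       (true ∷ a)  (false ∷ b) (true ∷ t)  (_ , ok) = cong (true ∷_) (pairScan-suc-nested d (suc k) a b t ok)
pairScan-suc-nested d       k       (false ∷ a) (true ∷ b)  (true ∷ t)  (_ , ok) = cong (false ∷_) (pairScan-suc-nested (suc d) k a b t ok)
pairScan-suc-nested d       k       (true ∷ a)  (true ∷ b)  (true ∷ t)  (_ , ok) = cong (true ∷_) (pairScan-suc-nested d k a b t ok)
pairScan-suc-nested d       (suc k) (false ∷ a) (true ∷ b)  (false ∷ t) (_ , ok) = cong (false ∷_) (pairScan-suc-nested (suc d) k a b t ok)
pairScan-suc-nested d       (suc k) (true ∷ a)  (true ∷ b)  (false ∷ t) (_ , ok) = cong (true ∷_) (pairScan-suc-nested d k a b t ok)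
pairScan-suc-nested d       zero    (false ∷ a) (true ∷ b)  (false ∷ t) _        = refl
pairScan-suc-nested d       zero    (true ∷ a)  (true ∷ b)  (false ∷ t) _        = refl

closesBracket-≤ : ∀ d a b → closesBracket d a b Bool.≤ a
closesBracket-≤ d false b = Bool.b≤b
closesBracket-≤ d true  b = BoolP.≤-maximum _

counterAfter-mono : ∀ {k d} a {x y} → k ≤ d → x Bool.≤ y → counterAfter k a x ≤ counterAfter d a y
counterAfter-mono false {y = false} k≤d Bool.b≤b = k≤d
counterAfter-mono false {y = true}  k≤d Bool.b≤b = s≤s k≤d
counterAfter-mono true  {y = false} k≤d Bool.b≤b = ℕP.pred-mono-≤ k≤d
counterAfter-mono true  {y = true}  k≤d Bool.b≤b = k≤d
counterAfter-mono false             k≤d Bool.f≤t = ℕP.m≤n⇒m≤1+n k≤d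
counterAfter-mono {d = d} true      k≤d Bool.f≤t = ℕP.≤-trans (ℕP.pred-mono-≤ k≤d) (ℕP.pred[n]≤n {d})

-- Since pairScan l b t ⊆ b, the scan of a against it never has more open brackets than the scan
-- of a against b: this is the invariant k ≤ d, which forces k = 0 at the moved column.
pairScan-move-nested : ∀ {n} d k l (a b t : Vec Bool n) c → k ≤ d → Movable d a b c →
  pairScan k a (pairScan l b t) ≡ pairScan k (addAt c a) (pairScan l (delAt c b) t)
pairScan-move-nested d k l (a₀ ∷ a) (b₀ ∷ b) (t₀ ∷ t) (suc c) k≤d m =
  cong (closesBracket k a₀ s₀ ∷_)
    (pairScan-move-nested (counterAfter d a₀ b₀) (counterAfter k a₀ s₀) (counterAfter l b₀ t₀) a b t c
       (counterAfter-mono a₀ k≤d (closesBracket-≤ l b₀ t₀)) m)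
  where s₀ = closesBracket l b₀ t₀
pairScan-move-nested .0 .0 zero    (.false ∷ a) (.true ∷ b) (false ∷ t) zero z≤n (refl , refl , refl , ok) = refl
pairScan-move-nested .0 .0 l       (.false ∷ a) (.true ∷ b) (true ∷ t)  zero z≤n (refl , refl , refl , ok) =
  cong (false ∷_) (pairScan-suc-nested 0 l a b t ok)
pairScan-move-nested .0 .0 (suc l) (.false ∷ a) (.true ∷ b) (false ∷ t) zero z≤n (refl , refl , refl , ok) =
  cong (false ∷_) (pairScan-suc-nested 0 l a b t ok)

-- The leftmost unmatched "(" of two rows

-- Whether an open bracket with h further open brackets stacked on top of it is eventually closed.
isClosed : ∀ {n} → ℕ → Vec Bool n → Vec Bool n → Bool
isClosed h       []          []          = false
isClosed h       (false ∷ a) (false ∷ b) = isClosed h a b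
isClosed h       (false ∷ a) (true ∷ b)  = isClosed (suc h) a b
isClosed h       (true ∷ a)  (true ∷ b)  = isClosed h a b
isClosed zero    (true ∷ a)  (false ∷ b) = true
isClosed (suc h) (true ∷ a)  (false ∷ b) = isClosed h a b

firstUnmatchedCol : ∀ {n} → Vec Bool n → Vec Bool n → Maybe (Fin n)
firstUnmatchedCol []          []         = nothing
firstUnmatchedCol (false ∷ a) (true ∷ b) =
  if isClosed 0 a b then Maybe.map suc (firstUnmatchedCol a b) else just zero
firstUnmatchedCol (_ ∷ a)     (_ ∷ b)    = Maybe.map suc (firstUnmatchedCol a b)

isClosed-suc : ∀ {n} h (a b : Vec Bool n) → isClosed (suc h) a b ≡ true → isClosed h a b ≡ true
isClosed-suc h       []          []          ()
isClosed-suc h       (false ∷ a) (false ∷ b) p = isClosed-suc h a b p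
isClosed-suc h       (false ∷ a) (true ∷ b)  p = isClosed-suc (suc h) a b p
isClosed-suc zero    (true ∷ a)  (false ∷ b) p = refl
isClosed-suc (suc h) (true ∷ a)  (false ∷ b) p = isClosed-suc h a b p
isClosed-suc h       (true ∷ a)  (true ∷ b)  p = isClosed-suc h a b p

isClosed-zero : ∀ {n} h (a b : Vec Bool n) → isClosed h a b ≡ true → isClosed 0 a b ≡ true
isClosed-zero zero    a b p = p
isClosed-zero (suc h) a b p = isClosed-zero h a b (isClosed-suc h a b p)

unclosed⇒staysPositive : ∀ {n} h (a b : Vec Bool n) → isClosed h a b ≡ false → StaysPositive (suc h) a b
unclosed⇒staysPositive h       []          []          p = _
unclosed⇒staysPositive h       (false ∷ a) (false ∷ b) p = s≤s z≤n , unclosed⇒staysPositive h a b p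
unclosed⇒staysPositive h       (false ∷ a) (true ∷ b)  p = s≤s z≤n , unclosed⇒staysPositive (suc h) a b p
unclosed⇒staysPositive (suc h) (true ∷ a)  (false ∷ b) p = s≤s z≤n , unclosed⇒staysPositive h a b p
unclosed⇒staysPositive h       (true ∷ a)  (true ∷ b)  p = s≤s z≤n , unclosed⇒staysPositive h a b p

-- All d currently open brackets get closed; it suffices that the lowest one is.
OpenBracketsClose : ∀ {n} → ℕ → Vec Bool n → Vec Bool n → Set
OpenBracketsClose zero    a b = ⊤
OpenBracketsClose (suc d) a b = isClosed d a b ≡ true

movable-suc : ∀ {n} d a₀ b₀ (a b : Vec Bool n) c →
  (∀ c′ → firstUnmatchedCol a b ≡ just c′ → Movable (counterAfter d a₀ b₀) a b c′) →
  Maybe.map suc (firstUnmatchedCol a b) ≡ just c → Movable d (a₀ ∷ a) (b₀ ∷ b) c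
movable-suc d a₀ b₀ a b c movable eq with firstUnmatchedCol a b
... | just c′ with refl ← eq = movable c′ refl

firstUnmatchedCol-movable : ∀ {n} d (a b : Vec Bool n) c → OpenBracketsClose d a b →
                            firstUnmatchedCol a b ≡ just c → Movable d a b c
firstUnmatchedCol-movable zero (false ∷ a) (false ∷ b) c inv =
  movable-suc zero false false a b c λ c′ → firstUnmatchedCol-movable zero a b c′ inv
firstUnmatchedCol-movable (suc d) (false ∷ a) (false ∷ b) c inv =
  movable-suc (suc d) false false a b c λ c′ → firstUnmatchedCol-movable (suc d) a b c′ inv
firstUnmatchedCol-movable zero (true ∷ a) (true ∷ b) c inv =
  movable-suc zero true true a b c λ c′ → firstUnmatchedCol-movable zero a b c′ inv
firstUnmatchedCol-movable (suc d) (true ∷ a) (true ∷ b) c inv =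
  movable-suc (suc d) true true a b c λ c′ → firstUnmatchedCol-movable (suc d) a b c′ inv
firstUnmatchedCol-movable zero (true ∷ a) (false ∷ b) c inv =
  movable-suc zero true false a b c λ c′ → firstUnmatchedCol-movable zero a b c′ _
firstUnmatchedCol-movable (suc zero) (true ∷ a) (false ∷ b) c inv =
  movable-suc 1 true false a b c λ c′ → firstUnmatchedCol-movable zero a b c′ _
firstUnmatchedCol-movable (suc (suc d)) (true ∷ a) (false ∷ b) c inv =
  movable-suc (suc (suc d)) true false a b c λ c′ → firstUnmatchedCol-movable (suc d) a b c′ inv
firstUnmatchedCol-movable d (false ∷ a) (true ∷ b) c inv with isClosed 0 a b in closed
firstUnmatchedCol-movable zero (false ∷ a) (true ∷ b) c inv | true =
  movable-suc zero false true a b c λ c′ → firstUnmatchedCol-movable 1 a b c′ closed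
firstUnmatchedCol-movable (suc d) (false ∷ a) (true ∷ b) c inv | true =
  movable-suc (suc d) false true a b c λ c′ → firstUnmatchedCol-movable (suc (suc d)) a b c′ inv
firstUnmatchedCol-movable zero (false ∷ a) (true ∷ b) zero inv | false = λ _ →
  refl , refl , refl , unclosed⇒staysPositive 0 a b closed
firstUnmatchedCol-movable (suc d) (false ∷ a) (true ∷ b) zero inv | false
  with () ← trans (sym (isClosed-zero (suc d) a b inv)) closed

-- Bracketing of a word

≡ᵇ-refl : ∀ n → (n ≡ᵇ n) ≡ true
≡ᵇ-refl zero    = refl
≡ᵇ-refl (suc n) = ≡ᵇ-refl n

≢⇒≡ᵇ-false : ∀ {m n} → m ≢ n → (m ≡ᵇ n) ≡ false
≢⇒≡ᵇ-false {zero}  {zero}  m≢n = ⊥-elim (m≢n refl)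
≢⇒≡ᵇ-false {zero}  {suc n} m≢n = refl
≢⇒≡ᵇ-false {suc m} {zero}  m≢n = refl
≢⇒≡ᵇ-false {suc m} {suc n} m≢n = ≢⇒≡ᵇ-false (m≢n ∘ cong suc)

letters : ∀ {n} → List (Ball n) → List ℕ
letters = List.map proj₁

isClosedʷ : ℕ → ℕ → List ℕ → Bool
isClosedʷ j h [] = false
isClosedʷ j h (x ∷ xs) with x ≡ᵇ suc j | x ≡ᵇ j
... | true  | _     = isClosedʷ j (suc h) xs
... | false | false = isClosedʷ j h xs
... | false | true with h
...   | zero   = true
...   | suc h′ = isClosedʷ j h′ xs

bracketFlags : ℕ → ℕ → List ℕ → List Bool
bracketFlags j d [] = []
bracketFlags j d (x ∷ xs) with x ≡ᵇ suc j | x ≡ᵇ j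
... | true  | _     = isClosedʷ j 0 xs ∷ bracketFlags j (suc d) xs
... | false | false = false ∷ bracketFlags j d xs
... | false | true  = isPositive d ∷ bracketFlags j (pred d) xs

matchGo-unstacked : ∀ j p st k w → p < k → All (p ≢_) st → any (p ≡ᵇ_) (matchGo j st k w) ≡ false
matchGo-unstacked j p st k []      p<k p∉st = refl
matchGo-unstacked j p st k (x ∷ w) p<k p∉st with x ≡ᵇ suc j | x ≡ᵇ j
... | true  | _     = matchGo-unstacked j p (k ∷ st) (suc k) w (ℕP.m<n⇒m<1+n p<k) (ℕP.<⇒≢ p<k ∷ p∉st)
... | false | false = matchGo-unstacked j p st (suc k) w (ℕP.m<n⇒m<1+n p<k) p∉st
... | false | true with st | p∉st
...   | []     | []         = matchGo-unstacked j p [] (suc k) w (ℕP.m<n⇒m<1+n p<k) []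
...   | q ∷ st | p≢q ∷ p∉st rewrite ≢⇒≡ᵇ-false p≢q | ≢⇒≡ᵇ-false (ℕP.<⇒≢ p<k) =
  matchGo-unstacked j p st (suc k) w (ℕP.m<n⇒m<1+n p<k) p∉st

matchGo-stacked : ∀ j s₁ p s₂ k w → p < k → All (p <_) s₁ →
  any (p ≡ᵇ_) (matchGo j (s₁ ++ p ∷ s₂) k w) ≡ isClosedʷ j (length s₁) w
matchGo-stacked j s₁ p s₂ k []      p<k p<s₁ = refl
matchGo-stacked j s₁ p s₂ k (x ∷ w) p<k p<s₁ with x ≡ᵇ suc j | x ≡ᵇ j
... | true  | _     = matchGo-stacked j (k ∷ s₁) p s₂ (suc k) w (ℕP.m<n⇒m<1+n p<k) (p<k ∷ p<s₁)
... | false | false = matchGo-stacked j s₁ p s₂ (suc k) w (ℕP.m<n⇒m<1+n p<k) p<s₁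
... | false | true with s₁ | p<s₁
...   | []     | [] rewrite ≡ᵇ-refl p = refl
...   | q ∷ s₁ | p<q ∷ p<s₁ rewrite ≢⇒≡ᵇ-false (ℕP.<⇒≢ p<q) | ≢⇒≡ᵇ-false (ℕP.<⇒≢ p<k) =
  matchGo-stacked j s₁ p s₂ (suc k) w (ℕP.m<n⇒m<1+n p<k) p<s₁

flags : ℕ → List ℕ → ℕ → List Bool
flags k M zero    = []
flags k M (suc n) = any (k ≡ᵇ_) M ∷ flags (suc k) M n

flags-∷ : ∀ {q k} M n → q < k → flags k (q ∷ M) n ≡ flags k M n
flags-∷         M zero    q<k = refl
flags-∷ {q} {k} M (suc n) q<k rewrite ≢⇒≡ᵇ-false (ℕP.>⇒≢ q<k) =
  cong (any (k ≡ᵇ_) M ∷_) (flags-∷ M n (ℕP.m<n⇒m<1+n q<k))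

applyUpTo-flags : ∀ k M n → applyUpTo (λ m → any ((k + m) ≡ᵇ_) M) n ≡ flags k M n
applyUpTo-flags k M zero    = refl
applyUpTo-flags k M (suc n) = cong₂ _∷_ (cong (λ p → any (p ≡ᵇ_) M) (ℕP.+-identityʳ k)) (begin
  applyUpTo (λ m → any ((k + suc m) ≡ᵇ_) M) n ≡⟨ applyUpTo-cong (λ m → cong (λ p → any (p ≡ᵇ_) M) (ℕP.+-suc k m)) n ⟩
  applyUpTo (λ m → any ((suc k + m) ≡ᵇ_) M) n ≡⟨ applyUpTo-flags (suc k) M n ⟩
  flags (suc k) M n                           ∎)
  where
  open ≡-Reasoning
  applyUpTo-cong : ∀ {A : Set} {f g : ℕ → A} → (∀ m → f m ≡ g m) → ∀ n → applyUpTo f n ≡ applyUpTo g n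
  applyUpTo-cong f≗g zero    = refl
  applyUpTo-cong f≗g (suc n) = cong₂ _∷_ (f≗g 0) (applyUpTo-cong (f≗g ∘ suc) n)

matchGo-flags : ∀ j st k w → All (_< k) st → flags k (matchGo j st k w) (length w) ≡ bracketFlags j (length st) w
matchGo-flags j st k []      st<k = refl
matchGo-flags j st k (x ∷ w) st<k with x ≡ᵇ suc j | x ≡ᵇ j
... | true  | _     = cong₂ _∷_
  (matchGo-stacked j [] k st (suc k) w (ℕP.n<1+n k) [])
  (matchGo-flags j (k ∷ st) (suc k) w (ℕP.n<1+n k ∷ All.map ℕP.m<n⇒m<1+n st<k))
... | false | false = cong₂ _∷_
  (matchGo-unstacked j k st (suc k) w (ℕP.n<1+n k) (All.map ℕP.>⇒≢ st<k))
  (matchGo-flags j st (suc k) w (All.map ℕP.m<n⇒m<1+n st<k))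
... | false | true with st | st<k
...   | []     | [] = cong₂ _∷_
  (matchGo-unstacked j k [] (suc k) w (ℕP.n<1+n k) [])
  (matchGo-flags j [] (suc k) w [])
...   | q ∷ st | q<k ∷ st<k rewrite ≢⇒≡ᵇ-false (ℕP.>⇒≢ q<k) | ≡ᵇ-refl k = cong (true ∷_) (begin
  flags (suc k) (q ∷ k ∷ matchGo j st (suc k) w) (length w) ≡⟨ flags-∷ _ (length w) (ℕP.m<n⇒m<1+n q<k) ⟩
  flags (suc k) (k ∷ matchGo j st (suc k) w) (length w)     ≡⟨ flags-∷ _ (length w) (ℕP.n<1+n k) ⟩
  flags (suc k) (matchGo j st (suc k) w) (length w)         ≡⟨ matchGo-flags j st (suc k) w (All.map ℕP.m<n⇒m<1+n st<k) ⟩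
  bracketFlags j (length st) w                              ∎)
  where open ≡-Reasoning

matchedFlags-bracketFlags : ∀ j w → matchedFlags j w ≡ bracketFlags j 0 w
matchedFlags-bracketFlags j w = begin
  matchedFlags j w                                              ≡⟨ ListP.map-upTo _ (length w) ⟩
  applyUpTo (λ m → any (m ≡ᵇ_) (matchGo j [] 0 w)) (length w) ≡⟨ applyUpTo-flags 0 _ (length w) ⟩
  flags 0 (matchGo j [] 0 w) (length w)                         ≡⟨ matchGo-flags j [] 0 w [] ⟩
  bracketFlags j 0 w                                            ∎
  where open ≡-Reasoning

bracketed-bracketFlags : ∀ {n L} j (bs : Tensor n L) →
  bracketed j bs ≡ List.zip (colWordT bs) (bracketFlags j 0 (letters (colWordT bs)))
bracketed-bracketFlags j bs = cong (List.zip (colWordT bs)) (matchedFlags-bracketFlags j (colWord bs))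

restrict : ∀ {n} → ℕ → List (Ball n) → List (Ball n)
restrict j [] = []
restrict j ((r , c) ∷ xs) with r ≡ᵇ suc j | r ≡ᵇ j
... | true  | _     = (r , c) ∷ restrict j xs
... | false | false = restrict j xs
... | false | true  = (r , c) ∷ restrict j xs

firstUnmatchedʷ : ∀ {n} → ℕ → ℕ → List (Ball n) → Maybe (Fin n)
firstUnmatchedʷ j d w = firstUnmatched j (List.zip w (bracketFlags j d (letters w)))

isClosedʷ-restrict : ∀ {n} j h (w : List (Ball n)) → isClosedʷ j h (letters (restrict j w)) ≡ isClosedʷ j h (letters w)
isClosedʷ-restrict j h [] = refl
isClosedʷ-restrict j h ((r , c) ∷ w) with r ≡ᵇ suc j in e₁ | r ≡ᵇ j in e₂
... | true  | _     rewrite e₁ = isClosedʷ-restrict j (suc h) w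
... | false | false = isClosedʷ-restrict j h w
... | false | true rewrite e₁ | e₂ with h
...   | zero   = refl
...   | suc h′ = isClosedʷ-restrict j h′ w

-- A repeated rewrite by e₁ reaches the occurrence that the first one exposes.
firstUnmatchedʷ-restrict : ∀ {n} j d (w : List (Ball n)) → firstUnmatchedʷ j d (restrict j w) ≡ firstUnmatchedʷ j d w
firstUnmatchedʷ-restrict j d [] = refl
firstUnmatchedʷ-restrict j d ((r , c) ∷ w) with r ≡ᵇ suc j in e₁ | r ≡ᵇ j in e₂
... | true  | _     rewrite e₁ | e₁ | isClosedʷ-restrict j 0 w with isClosedʷ j 0 (letters w)
...   | true  = firstUnmatchedʷ-restrict j (suc d) w
...   | false = refl
firstUnmatchedʷ-restrict j d ((r , c) ∷ w) | false | false rewrite e₁ = firstUnmatchedʷ-restrict j d w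
firstUnmatchedʷ-restrict j d ((r , c) ∷ w) | false | true rewrite e₁ | e₂ | e₁ = firstUnmatchedʷ-restrict j (pred d) w

-- The word of two rows

cell : ∀ {A : Set} → Bool → A → List A
cell b x = if b then [ x ] else []

map-cell : ∀ {A B : Set} (f : A → B) b x → List.map f (cell b x) ≡ cell b (f x)
map-cell f false x = refl
map-cell f true  x = refl

shift : ∀ {n} → Ball n → Ball (suc n)
shift = Product.map₂ suc

pairWord : ∀ {n} → ℕ → Vec Bool n → Vec Bool n → List (Ball n)
pairWord j []       []       = []
pairWord j (a ∷ as) (b ∷ bs) = cell b (suc j , zero) ++ cell a (j , zero) ++ List.map shift (pairWord j as bs)

letters-shift : ∀ {n} (w : List (Ball n)) → letters (List.map shift w) ≡ letters w
letters-shift w = sym (ListP.map-∘ w)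

firstUnmatched-shift : ∀ {n} j (w : List (Ball n)) fl →
  firstUnmatched j (List.zip (List.map shift w) fl) ≡ Maybe.map suc (firstUnmatched j (List.zip w fl))
firstUnmatched-shift j []            fl       = refl
firstUnmatched-shift j (_ ∷ w)       []       = refl
firstUnmatched-shift j ((r , c) ∷ w) (m ∷ fl) with r ≡ᵇ suc j | m
... | true  | false = refl
... | true  | true  = firstUnmatched-shift j w fl
... | false | _     = firstUnmatched-shift j w fl

firstUnmatchedʷ-shift : ∀ {n} j d (w : List (Ball n)) →
  firstUnmatchedʷ j d (List.map shift w) ≡ Maybe.map suc (firstUnmatchedʷ j d w)
firstUnmatchedʷ-shift j d w rewrite letters-shift w = firstUnmatched-shift j w _

module _ (j : ℕ) where
  private
    open≡ : (suc j ≡ᵇ suc j) ≡ true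
    open≡ = ≡ᵇ-refl j
    close≢ : (j ≡ᵇ suc j) ≡ false
    close≢ = ≢⇒≡ᵇ-false (ℕP.<⇒≢ (ℕP.n<1+n j))
    close≡ : (j ≡ᵇ j) ≡ true
    close≡ = ≡ᵇ-refl j

  isClosedʷ-open : ∀ h w → isClosedʷ j h (suc j ∷ w) ≡ isClosedʷ j (suc h) w
  isClosedʷ-open h w rewrite open≡ = refl

  isClosedʷ-close : ∀ h w → isClosedʷ j (suc h) (j ∷ w) ≡ isClosedʷ j h w
  isClosedʷ-close h w rewrite close≢ | close≡ = refl

  isClosedʷ-close₀ : ∀ w → isClosedʷ j 0 (j ∷ w) ≡ true
  isClosedʷ-close₀ w rewrite close≢ | close≡ = refl

  firstUnmatchedʷ-open : ∀ {n} d c (w : List (Ball n)) → firstUnmatchedʷ j d ((suc j , c) ∷ w)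
    ≡ (if isClosedʷ j 0 (letters w) then firstUnmatchedʷ j (suc d) w else just c)
  firstUnmatchedʷ-open d c w rewrite open≡ | open≡ with isClosedʷ j 0 (letters w)
  ... | true  = refl
  ... | false = refl

  firstUnmatchedʷ-close : ∀ {n} d c (w : List (Ball n)) → firstUnmatchedʷ j d ((j , c) ∷ w) ≡ firstUnmatchedʷ j (pred d) w
  firstUnmatchedʷ-close d c w rewrite close≢ | close≡ | close≢ = refl

isClosedʷ-pairWord : ∀ {n} j h (a b : Vec Bool n) → isClosedʷ j h (letters (pairWord j a b)) ≡ isClosed h a b
isClosedʷ-pairWord j h       []          []          = refl
isClosedʷ-pairWord j h       (false ∷ a) (false ∷ b) rewrite letters-shift (pairWord j a b) =
  isClosedʷ-pairWord j h a b
isClosedʷ-pairWord j h       (false ∷ a) (true ∷ b)  rewrite letters-shift (pairWord j a b) =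
  trans (isClosedʷ-open j h _) (isClosedʷ-pairWord j (suc h) a b)
isClosedʷ-pairWord j h       (true ∷ a)  (true ∷ b)  rewrite letters-shift (pairWord j a b) =
  trans (isClosedʷ-open j h _) (trans (isClosedʷ-close j h _) (isClosedʷ-pairWord j h a b))
isClosedʷ-pairWord j zero    (true ∷ a)  (false ∷ b) = isClosedʷ-close₀ j _
isClosedʷ-pairWord j (suc h) (true ∷ a)  (false ∷ b) rewrite letters-shift (pairWord j a b) =
  trans (isClosedʷ-close j h _) (isClosedʷ-pairWord j h a b)

firstUnmatchedʷ-shifted : ∀ {n} j d (a b : Vec Bool n) →
  firstUnmatchedʷ j d (List.map shift (pairWord j a b)) ≡ Maybe.map suc (firstUnmatchedCol a b)

firstUnmatchedʷ-pairWord : ∀ {n} j d (a b : Vec Bool n) → firstUnmatchedʷ j d (pairWord j a b) ≡ firstUnmatchedCol a b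
firstUnmatchedʷ-pairWord j d []          []          = refl
firstUnmatchedʷ-pairWord j d (false ∷ a) (false ∷ b) = firstUnmatchedʷ-shifted j d a b
firstUnmatchedʷ-pairWord j d (true ∷ a)  (false ∷ b) =
  trans (firstUnmatchedʷ-close j d zero _) (firstUnmatchedʷ-shifted j (pred d) a b)
firstUnmatchedʷ-pairWord j d (true ∷ a)  (true ∷ b)
  rewrite firstUnmatchedʷ-open j d zero ((j , zero) ∷ List.map shift (pairWord j a b))
        | isClosedʷ-close₀ j (letters (List.map shift (pairWord j a b))) =
  trans (firstUnmatchedʷ-close j (suc d) zero _) (firstUnmatchedʷ-shifted j d a b)
firstUnmatchedʷ-pairWord j d (false ∷ a) (true ∷ b)  =
  trans (firstUnmatchedʷ-open j d zero (List.map shift (pairWord j a b)))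
        (cong₂ (λ closed first → if closed then first else just zero)
               (trans (cong (isClosedʷ j 0) (letters-shift (pairWord j a b))) (isClosedʷ-pairWord j 0 a b))
               (firstUnmatchedʷ-shifted j (suc d) a b))

firstUnmatchedʷ-shifted j d a b =
  trans (firstUnmatchedʷ-shift j d (pairWord j a b)) (cong (Maybe.map suc) (firstUnmatchedʷ-pairWord j d a b))

-- Columns of an array

-- rows are numbered from 1 as in updRow; row 0 and the rows above L are empty
rowAt : ∀ {n L} → ℕ → Tensor n L → Subset n
rowAt zero          bs       = ∅
rowAt (suc r)       []       = ∅
rowAt (suc zero)    (b ∷ bs) = b
rowAt (suc (suc r)) (b ∷ bs) = rowAt (suc r) bs

column : ∀ {n L} → Tensor n L → Fin n → List (Ball n)
column {L = L} bs c = concatMap (λ r → cell (lookup (lookup bs r) c) (suc (toℕ r) , c)) (List.reverse (List.allFin L))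

raise : ∀ {n} → Ball n → Ball n
raise = Product.map₁ suc

column-∷ : ∀ {n L} b (bs : Tensor n L) c → column (b ∷ bs) c ≡ List.map raise (column bs c) ++ cell (lookup b c) (1 , c)
column-∷ {L = L} b bs c = begin
  concatMap f (List.reverse (zero ∷ List.tabulate suc))
    ≡⟨ cong (concatMap f) (ListP.unfold-reverse zero (List.tabulate suc)) ⟩
  concatMap f (List.reverse (List.tabulate suc) ++ [ zero ])
    ≡⟨ ListP.concatMap-++ f (List.reverse (List.tabulate suc)) [ zero ] ⟩
  concatMap f (List.reverse (List.tabulate suc)) ++ cell (lookup b c) (1 , c) ++ []
    ≡⟨ cong₂ _++_ upper (ListP.++-identityʳ _) ⟩
  List.map raise (column bs c) ++ cell (lookup b c) (1 , c) ∎
  where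
  open ≡-Reasoning
  f = λ r → cell (lookup (lookup (b ∷ bs) r) c) (suc (toℕ r) , c)
  g = λ r → cell (lookup (lookup bs r) c) (suc (toℕ r) , c)
  rows = List.reverse (List.allFin L)
  upper : concatMap f (List.reverse (List.tabulate suc)) ≡ List.map raise (column bs c)
  upper = begin
    concatMap f (List.reverse (List.tabulate suc))            ≡⟨ cong (concatMap f ∘ List.reverse) (sym (ListP.map-tabulate (λ r → r) suc)) ⟩
    concatMap f (List.reverse (List.map suc (List.allFin L))) ≡⟨ cong (concatMap f) (sym (ListP.reverse-map suc (List.allFin L))) ⟩
    concatMap f (List.map suc rows)                           ≡⟨ ListP.concatMap-map f suc rows ⟩
    concatMap (f ∘ suc) rows                                  ≡⟨ ListP.concatMap-cong (λ r → sym (map-cell raise _ _)) rows ⟩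
    concatMap (List.map raise ∘ g) rows                       ≡⟨ sym (ListP.map-concatMap raise g rows) ⟩
    List.map raise (column bs c)                              ∎

restrict-++ : ∀ {n} j (xs ys : List (Ball n)) → restrict j (xs ++ ys) ≡ restrict j xs ++ restrict j ys
restrict-++ j []             ys = refl
restrict-++ j ((r , c) ∷ xs) ys with r ≡ᵇ suc j | r ≡ᵇ j
... | true  | _     = cong ((r , c) ∷_) (restrict-++ j xs ys)
... | false | false = restrict-++ j xs ys
... | false | true  = cong ((r , c) ∷_) (restrict-++ j xs ys)

restrict-concatMap : ∀ {A : Set} {n} j (f : A → List (Ball n)) xs →
                     restrict j (concatMap f xs) ≡ concatMap (restrict j ∘ f) xs
restrict-concatMap j f []       = refl
restrict-concatMap j f (x ∷ xs) =
  trans (restrict-++ j (f x) (concatMap f xs)) (cong (restrict j (f x) ++_) (restrict-concatMap j f xs))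

restrict-raise : ∀ {n} j (xs : List (Ball n)) → restrict (suc j) (List.map raise xs) ≡ List.map raise (restrict j xs)
restrict-raise j []             = refl
restrict-raise j ((r , c) ∷ xs) with r ≡ᵇ suc j | r ≡ᵇ j
... | true  | _     = cong ((suc r , c) ∷_) (restrict-raise j xs)
... | false | false = restrict-raise j xs
... | false | true  = cong ((suc r , c) ∷_) (restrict-raise j xs)

restrict₀-raise-column : ∀ {n L} (bs : Tensor n L) c → restrict 0 (List.map raise (column bs c)) ≡ []
restrict₀-raise-column []       c = refl
restrict₀-raise-column (b ∷ bs) c rewrite column-∷ b bs c
  | ListP.map-++ raise (List.map raise (column bs c)) (cell (lookup b c) (1 , c))
  | restrict-++ 0 (List.map raise (List.map raise (column bs c))) (List.map raise (cell (lookup b c) (1 , c)))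
  = cong₂ _++_ (aboveTwo (column bs c)) (rowTwo (lookup b c))
  where
  aboveTwo : ∀ xs → restrict 0 (List.map raise (List.map raise xs)) ≡ []
  aboveTwo []       = refl
  aboveTwo (_ ∷ xs) = aboveTwo xs
  rowTwo : ∀ x → restrict 0 (List.map raise (cell x (1 , c))) ≡ []
  rowTwo false = refl
  rowTwo true  = refl

restrict-column : ∀ {n L} j (bs : Tensor n L) c →
  restrict j (column bs c) ≡ cell (lookup (rowAt (suc j) bs) c) (suc j , c) ++ cell (lookup (rowAt j bs) c) (j , c)
restrict-column zero    [] c rewrite VecP.lookup-replicate c false = refl
restrict-column (suc j) [] c rewrite VecP.lookup-replicate c false = refl
restrict-column j (b ∷ bs) c
  rewrite column-∷ b bs c | restrict-++ j (List.map raise (column bs c)) (cell (lookup b c) (1 , c)) = split j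
  where
  open ≡-Reasoning
  raised : ∀ j → restrict (suc j) (List.map raise (column bs c))
                 ≡ cell (lookup (rowAt (suc j) bs) c) (suc (suc j) , c) ++ cell (lookup (rowAt j bs) c) (suc j , c)
  raised j = begin
    restrict (suc j) (List.map raise (column bs c))                        ≡⟨ restrict-raise j (column bs c) ⟩
    List.map raise (restrict j (column bs c))                              ≡⟨ cong (List.map raise) (restrict-column j bs c) ⟩
    List.map raise (cell y (suc j , c) ++ cell z (j , c))                  ≡⟨ ListP.map-++ raise (cell y (suc j , c)) (cell z (j , c)) ⟩
    List.map raise (cell y (suc j , c)) ++ List.map raise (cell z (j , c)) ≡⟨ cong₂ _++_ (map-cell raise y _) (map-cell raise z _) ⟩
    cell y (suc (suc j) , c) ++ cell z (suc j , c)                         ∎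
    where
    y = lookup (rowAt (suc j) bs) c
    z = lookup (rowAt j bs) c
  split : ∀ j → restrict j (List.map raise (column bs c)) ++ restrict j (cell (lookup b c) (1 , c))
              ≡ cell (lookup (rowAt (suc j) (b ∷ bs)) c) (suc j , c) ++ cell (lookup (rowAt j (b ∷ bs)) c) (j , c)
  split zero rewrite restrict₀-raise-column bs c | VecP.lookup-replicate c false with lookup b c
  ... | false = refl
  ... | true  = refl
  split (suc zero) rewrite raised 0 | VecP.lookup-replicate c false with lookup (rowAt 1 bs) c | lookup b c
  ... | false | false = refl
  ... | false | true  = refl
  ... | true  | false = refl
  ... | true  | true  = refl
  split (suc (suc j)) rewrite raised (suc j) with lookup b c
  ... | false = ListP.++-identityʳ _
  ... | true  = ListP.++-identityʳ _

pairColumn : ∀ {n} → ℕ → Vec Bool n → Vec Bool n → Fin n → List (Ball n)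
pairColumn j a b c = cell (lookup b c) (suc j , c) ++ cell (lookup a c) (j , c)

pairWord-columns : ∀ {n} j (a b : Vec Bool n) → pairWord j a b ≡ concatMap (pairColumn j a b) (List.allFin n)
pairWord-columns j []       []       = refl
pairWord-columns {suc n} j (a₀ ∷ a) (b₀ ∷ b) = begin
  cell b₀ (suc j , zero) ++ cell a₀ (j , zero) ++ List.map shift (pairWord j a b)
    ≡⟨ sym (ListP.++-assoc (cell b₀ (suc j , zero)) _ _) ⟩
  f zero ++ List.map shift (pairWord j a b)
    ≡⟨ cong (f zero ++_) later ⟩
  concatMap f (List.allFin (suc n)) ∎
  where
  open ≡-Reasoning
  f = pairColumn j (a₀ ∷ a) (b₀ ∷ b)
  later : List.map shift (pairWord j a b) ≡ concatMap f (List.tabulate suc)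
  later = begin
    List.map shift (pairWord j a b)                                ≡⟨ cong (List.map shift) (pairWord-columns j a b) ⟩
    List.map shift (concatMap (pairColumn j a b) (List.allFin n)) ≡⟨ ListP.map-concatMap shift (pairColumn j a b) (List.allFin n) ⟩
    concatMap (List.map shift ∘ pairColumn j a b) (List.allFin n) ≡⟨ ListP.concatMap-cong shiftColumn (List.allFin n) ⟩
    concatMap (f ∘ suc) (List.allFin n)                            ≡⟨ sym (ListP.concatMap-map f suc (List.allFin n)) ⟩
    concatMap f (List.map suc (List.allFin n))                     ≡⟨ cong (concatMap f) (ListP.map-tabulate (λ c → c) suc) ⟩
    concatMap f (List.tabulate suc)                                ∎
    where
    shiftColumn : ∀ c → List.map shift (pairColumn j a b c) ≡ f (suc c)
    shiftColumn c = trans (ListP.map-++ shift (cell (lookup b c) (suc j , c)) (cell (lookup a c) (j , c)))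
                          (cong₂ _++_ (map-cell shift (lookup b c) _) (map-cell shift (lookup a c) _))

restrict-colWord : ∀ {n L} j (bs : Tensor n L) → restrict j (colWordT bs) ≡ pairWord j (rowAt j bs) (rowAt (suc j) bs)
restrict-colWord {n} j bs = begin
  restrict j (concatMap (column bs) (List.allFin n))                       ≡⟨ restrict-concatMap j (column bs) (List.allFin n) ⟩
  concatMap (restrict j ∘ column bs) (List.allFin n)                      ≡⟨ ListP.concatMap-cong (restrict-column j bs) (List.allFin n) ⟩
  concatMap (pairColumn j (rowAt j bs) (rowAt (suc j) bs)) (List.allFin n) ≡⟨ sym (pairWord-columns j (rowAt j bs) (rowAt (suc j) bs)) ⟩
  pairWord j (rowAt j bs) (rowAt (suc j) bs)                              ∎
  where open ≡-Reasoning

colWord-pair : ∀ {n} (a b : Subset n) → colWordT (a ∷ b ∷ []) ≡ pairWord 1 a b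
colWord-pair {n} a b = begin
  concatMap (λ c → cell (lookup b c) (2 , c) ++ cell (lookup a c) (1 , c) ++ []) (List.allFin n)
    ≡⟨ ListP.concatMap-cong (λ c → cong (cell (lookup b c) (2 , c) ++_) (ListP.++-identityʳ _)) (List.allFin n) ⟩
  concatMap (pairColumn 1 a b) (List.allFin n)
    ≡⟨ sym (pairWord-columns 1 a b) ⟩
  pairWord 1 a b ∎
  where open ≡-Reasoning

firstUnmatched-bracketed : ∀ {n L} j (bs : Tensor n L) →
  firstUnmatched j (bracketed j bs) ≡ firstUnmatchedCol (rowAt j bs) (rowAt (suc j) bs)
firstUnmatched-bracketed j bs = begin
  firstUnmatched j (bracketed j bs)                                ≡⟨ cong (firstUnmatched j) (bracketed-bracketFlags j bs) ⟩
  firstUnmatchedʷ j 0 (colWordT bs)                                ≡⟨ sym (firstUnmatchedʷ-restrict j 0 (colWordT bs)) ⟩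
  firstUnmatchedʷ j 0 (restrict j (colWordT bs))                   ≡⟨ cong (firstUnmatchedʷ j 0) (restrict-colWord j bs) ⟩
  firstUnmatchedʷ j 0 (pairWord j (rowAt j bs) (rowAt (suc j) bs)) ≡⟨ firstUnmatchedʷ-pairWord j 0 (rowAt j bs) (rowAt (suc j) bs) ⟩
  firstUnmatchedCol (rowAt j bs) (rowAt (suc j) bs)                ∎
  where open ≡-Reasoning

-- θ of two rows as a counter scan

matchedOneAt : ∀ {n} → Fin n → Ball n × Bool → Bool
matchedOneAt c ((r , c′) , m) = (r ≡ᵇ 1) ∧ (toℕ c′ ≡ᵇ toℕ c) ∧ m

matchedOneAt-pairScan : ∀ {n} d (a b : Subset n) →
  Vec.tabulate (λ c → any (matchedOneAt c) (List.zip (pairWord 1 a b) (bracketFlags 1 d (letters (pairWord 1 a b)))))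
  ≡ pairScan d a b
matchedOneAt-pairScan d []       []       = refl
matchedOneAt-pairScan d (a₀ ∷ a) (b₀ ∷ b) = byHead a₀ b₀
  where
  w = List.map shift (pairWord 1 a b)
  flagsAfter : ℕ → List Bool
  flagsAfter d′ = bracketFlags 1 d′ (letters w)
  head : ∀ d′ → any (matchedOneAt zero) (List.zip w (flagsAfter d′)) ≡ false
  head d′ = noneAtZero (pairWord 1 a b) (flagsAfter d′)
    where
    noneAtZero : ∀ {m} (v : List (Ball m)) fl → any (matchedOneAt zero) (List.zip (List.map shift v) fl) ≡ false
    noneAtZero []            fl       = refl
    noneAtZero (_ ∷ v)       []       = refl
    noneAtZero ((r , _) ∷ v) (_ ∷ fl) = cong₂ _∨_ (BoolP.∧-zeroʳ (r ≡ᵇ 1)) (noneAtZero v fl)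
  tail : ∀ d′ → Vec.tabulate (λ c → any (matchedOneAt (suc c)) (List.zip w (flagsAfter d′))) ≡ pairScan d′ a b
  tail d′ rewrite letters-shift (pairWord 1 a b) =
    trans (VecP.tabulate-cong (λ c → unshift c (pairWord 1 a b) _)) (matchedOneAt-pairScan d′ a b)
    where
    unshift : ∀ {m} (c : Fin m) (v : List (Ball m)) fl →
              any (matchedOneAt (suc c)) (List.zip (List.map shift v) fl) ≡ any (matchedOneAt c) (List.zip v fl)
    unshift c []      fl       = refl
    unshift c (_ ∷ v) []       = refl
    unshift c (_ ∷ v) (_ ∷ fl) = cong (_ ∨_) (unshift c v fl)
  byHead : ∀ a₀ b₀ → Vec.tabulate (λ c → any (matchedOneAt c)
             (List.zip (pairWord 1 (a₀ ∷ a) (b₀ ∷ b)) (bracketFlags 1 d (letters (pairWord 1 (a₀ ∷ a) (b₀ ∷ b))))))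
           ≡ pairScan d (a₀ ∷ a) (b₀ ∷ b)
  byHead false false = cong₂ _∷_ (head d) (tail d)
  byHead false true  = cong₂ _∷_ (head (suc d)) (tail (suc d))
  byHead true  false = cong₂ _∷_ (trans (cong (isPositive d ∨_) (head (pred d))) (BoolP.∨-identityʳ (isPositive d))) (tail (pred d))
  byHead true  true  = cong₂ _∷_ refl (tail d)

θ₂-pairScan : ∀ {n} (a b : Subset n) → θ₂ a b ≡ pairScan 0 a b
θ₂-pairScan a b = begin
  Vec.tabulate (λ c → any (matchedOneAt c) (bracketed 1 (a ∷ b ∷ [])))
    ≡⟨ cong (λ w → Vec.tabulate (λ c → any (matchedOneAt c) w)) (bracketed-bracketFlags 1 (a ∷ b ∷ [])) ⟩
  Vec.tabulate (λ c → any (matchedOneAt c) (List.zip (colWordT (a ∷ b ∷ [])) (bracketFlags 1 0 (letters (colWordT (a ∷ b ∷ []))))))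
    ≡⟨ cong (λ w → Vec.tabulate (λ c → any (matchedOneAt c) (List.zip w (bracketFlags 1 0 (letters w))))) (colWord-pair a b) ⟩
  Vec.tabulate (λ c → any (matchedOneAt c) (List.zip (pairWord 1 a b) (bracketFlags 1 0 (letters (pairWord 1 a b)))))
    ≡⟨ matchedOneAt-pairScan 0 a b ⟩
  pairScan 0 a b ∎
  where open ≡-Reasoning

-- Invariance of θ

nothing-movable-from-∅ : ∀ {n} d (a : Vec Bool n) c → Movable d a ∅ c → Empty
nothing-movable-from-∅ d (a₀ ∷ a) zero    (_ , () , _)
nothing-movable-from-∅ d (a₀ ∷ a) (suc c) m = nothing-movable-from-∅ _ a c m

θ-∷ : ∀ {n k} b (bs : Tensor n (suc k)) → θ (b ∷ bs) ≡ θ₂ b (θ bs)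
θ-∷ b (_ ∷ _) = refl

θ-move : ∀ {n k} i (bs : Tensor n (suc k)) c → Movable 0 (rowAt (suc i) bs) (rowAt (suc (suc i)) bs) c →
         θ bs ≡ θ (updRow (suc i) (addAt c) (updRow (suc (suc i)) (delAt c) bs))
θ-move zero    (a ∷ [])         c m with () ← nothing-movable-from-∅ 0 a c m
θ-move zero    (a ∷ b ∷ [])     c m = begin
  θ₂ a b                             ≡⟨ θ₂-pairScan a b ⟩
  pairScan 0 a b                     ≡⟨ pairScan-move 0 a b c m ⟩
  pairScan 0 (addAt c a) (delAt c b) ≡⟨ sym (θ₂-pairScan (addAt c a) (delAt c b)) ⟩
  θ₂ (addAt c a) (delAt c b)         ∎
  where open ≡-Reasoning
θ-move zero    (a ∷ b ∷ t ∷ ts) c m = begin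
  θ₂ a (θ₂ b s)                                     ≡⟨ cong (θ₂ a) (θ₂-pairScan b s) ⟩
  θ₂ a (pairScan 0 b s)                             ≡⟨ θ₂-pairScan a _ ⟩
  pairScan 0 a (pairScan 0 b s)                     ≡⟨ pairScan-move-nested 0 0 0 a b s c z≤n m ⟩
  pairScan 0 (addAt c a) (pairScan 0 (delAt c b) s) ≡⟨ sym (θ₂-pairScan (addAt c a) _) ⟩
  θ₂ (addAt c a) (pairScan 0 (delAt c b) s)         ≡⟨ sym (cong (θ₂ (addAt c a)) (θ₂-pairScan (delAt c b) s)) ⟩
  θ₂ (addAt c a) (θ₂ (delAt c b) s)                 ∎
  where
  open ≡-Reasoning
  s = θ (t ∷ ts)
θ-move (suc i) (b ∷ [])         c m with () ← nothing-movable-from-∅ 0 ∅ c m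
θ-move (suc i) (b ∷ b′ ∷ bs)    c m = begin
  θ₂ b (θ (b′ ∷ bs))        ≡⟨ cong (θ₂ b) (θ-move i (b′ ∷ bs) c m) ⟩
  θ₂ b (θ moved)            ≡⟨ sym (θ-∷ b moved) ⟩
  θ (b ∷ moved)             ∎
  where
  open ≡-Reasoning
  moved = updRow (suc i) (addAt c) (updRow (suc (suc i)) (delAt c) (b′ ∷ bs))

θ-eDownStep : ∀ {n k} i (bs bs′ : Tensor n (suc k)) → eDownStep (suc i) bs ≡ just bs′ → θ bs ≡ θ bs′
θ-eDownStep i bs bs′ step with firstUnmatched (suc i) (bracketed (suc i) bs) in first
... | just c with refl ← step =
  θ-move i bs c (firstUnmatchedCol-movable 0 (rowAt (suc i) bs) (rowAt (suc (suc i)) bs) c _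
                   (trans (sym (firstUnmatched-bracketed (suc i) bs)) first))

θ-eDownStarFuel : ∀ {n k} fuel i (bs : Tensor n (suc k)) → θ bs ≡ θ (eDownStarFuel fuel (suc i) bs)
θ-eDownStarFuel zero       i bs = refl
θ-eDownStarFuel (suc fuel) i bs with eDownStep (suc i) bs in step
... | nothing  = refl
... | just bs′ = trans (θ-eDownStep i bs bs′ step) (θ-eDownStarFuel fuel i bs′)

θ-eDownStar : ∀ {n k} i (bs : Tensor n (suc k)) → 1 ≤ i → θ bs ≡ θ (eDownStar i bs)
θ-eDownStar {n} (suc i) bs _ = θ-eDownStarFuel n i bs

lemma3p16 : ((n : ℕ) (a b c : Subset n) →
                θ (a ∷ b ∷ c ∷ []) ≡ θ (eDownStar 1 (a ∷ b ∷ c ∷ [])))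
            × ((n k : ℕ) (bs : Tensor n (suc k)) (i : ℕ) → 1 ≤ i → i < suc k →
                θ bs ≡ θ (eDownStar i bs))
lemma3p16 = (λ n a b c → θ-eDownStar 1 (a ∷ b ∷ c ∷ []) (s≤s z≤n))
          , (λ n k bs i 1≤i _ → θ-eDownStar i bs 1≤i)
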